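{- Let $\omega$ be a primitive $d$-th root of unity with $d\geq 2$ and $n\equiv 0\pmod d$. Then $$ \frac{1}{[n-1]_\omega}\genfrac{[}{]}{0pt}{}{n-2+a+b+c}{n-2,\,a,\,b,\,c}_\omega=\binom{\lfloor\frac{n+a+b+c}{d}\rfloor-1}{\frac{n}{d}-1,\ \lfloor\frac{a}{d}\rfloor,\ \lfloor\frac{b}{d}\rfloor,\ \lfloor\frac{c}{d}\rfloor} $$ if one of $a$, $b$ and $c$ equals $1\pmod d$ and the others equal $0\pmod d$, or $d=2$ and $a\equiv b\equiv c\equiv 0\pmod d$. Furthermore, $$ \frac{1}{[n-1]_\omega}\genfrac{[}{]}{0pt}{}{n-2+a+b+c}{n-2,\,a,\,b,\,c}_\omega=0 $$ otherwise, except if $d>2$ and $a\equiv b\equiv c\equiv 0\pmod d$ -- no statement is made for this case.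
   Context: $a,b,c$ are non-negative integers. Here $[n]_q=1+q+\dots+q^{n-1}$, $[n]_q!=[n]_q[n-1]_q\cdots[1]_q$, and the $q$-multinomial coefficient is $\genfrac{[}{]}{0pt}{}{n_1+\dots+n_r}{n_1,\dots,n_r}_q=\frac{[n_1+\dots+n_r]_q!}{[n_1]_q!\cdots[n_r]_q!}$, evaluated at $q=\omega$. -}

module Defs where

open import Level using (Level)
open import Algebra.Bundles using (CommutativeRing)
open import Data.Nat as ℕ using (ℕ; zero; suc; _∸_; _<_; NonZero; _!)
open import Data.Nat.DivMod using (_/_)
open import Data.Nat.Properties using (_!≢0)
open import Data.Product using (_×_)
open import Data.Sum using (_⊎_)
open import Relation.Nullary using (¬_)
open import Relation.Binary.PropositionalEquality using (_≡_)

multinomial : ℕ → ℕ → ℕ → ℕ → ℕ → ℕ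
multinomial m k₁ k₂ k₃ k₄ =
  _/_ (m !) (k₁ ! ℕ.* k₂ ! ℕ.* k₃ ! ℕ.* k₄ !) {{nz}}
  where
  instance
    nz : NonZero (k₁ ! ℕ.* k₂ ! ℕ.* k₃ ! ℕ.* k₄ !)
    nz = Data.Nat.Properties.m*n≢0 _ _ {{Data.Nat.Properties.m*n≢0 _ _ {{Data.Nat.Properties.m*n≢0 _ _ {{k₁ !≢0}} {{k₂ !≢0}}}} {{k₃ !≢0}}}} {{k₄ !≢0}}

module _ {c ℓ : Level} (R : CommutativeRing c ℓ) where
  open CommutativeRing R

  pow : Carrier → ℕ → Carrier
  pow x zero    = 1#
  pow x (suc k) = x * pow x k

  fromℕ : ℕ → Carrier
  fromℕ zero    = 0#
  fromℕ (suc k) = 1# + fromℕ k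

  qInt : Carrier → ℕ → Carrier
  qInt q zero    = 0#
  qInt q (suc k) = 1# + q * qInt q k

  qBinom : Carrier → ℕ → ℕ → Carrier
  qBinom q n       zero    = 1#
  qBinom q zero    (suc k) = 0#
  qBinom q (suc n) (suc k) = qBinom q n k + pow q (suc k) * qBinom q n (suc k)

  -- q-multinomial [n₁+n₂+n₃+n₄ ; n₁,n₂,n₃,n₄]_q (polynomial in q) evaluated at q
  qMultinomial4 : Carrier → ℕ → ℕ → ℕ → ℕ → Carrier
  qMultinomial4 q n₁ n₂ n₃ n₄ =
    qBinom q (n₁ ℕ.+ n₂) n₂ * qBinom q (n₁ ℕ.+ n₂ ℕ.+ n₃) n₃
      * qBinom q (n₁ ℕ.+ n₂ ℕ.+ n₃ ℕ.+ n₄) n₄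

  IsPrimitiveRoot : ℕ → Carrier → Set ℓ
  IsPrimitiveRoot d ω = (pow ω d ≈ 1#) × (∀ k → 0 < k → k < d → ¬ (pow ω k ≈ 1#))

  IsIntegralDomain : Set (c Level.⊔ ℓ)
  IsIntegralDomain = (¬ (1# ≈ 0#)) × (∀ x y → x * y ≈ 0# → (x ≈ 0#) ⊎ (y ≈ 0#))

open import Data.Nat.DivMod using (_%_)

Good : (d : ℕ) .{{_ : NonZero d}} → ℕ → ℕ → ℕ → Set
Good d a b c = ((a % d ≡ 1) × (b % d ≡ 0) × (c % d ≡ 0))
             ⊎ ((a % d ≡ 0) × (b % d ≡ 1) × (c % d ≡ 0))
             ⊎ ((a % d ≡ 0) × (b % d ≡ 0) × (c % d ≡ 1))
             ⊎ ((d ≡ 2) × (a % d ≡ 0) × (b % d ≡ 0) × (c % d ≡ 0))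

Excluded : (d : ℕ) .{{_ : NonZero d}} → ℕ → ℕ → ℕ → Set
Excluded d a b c = (2 < d) × (a % d ≡ 0) × (b % d ≡ 0) × (c % d ≡ 0)

{-# OPTIONS --safe #-}
module Submission where

-- At a primitive d-th root of unity ω, [d]_ω = 0 while [i]_ω ≠ 0 for 0 < i < d, so the q-binomial
-- [d choose j]_ω vanishes for 0 < j < d. Fed into the q-Pascal recurrence this gives the q-Lucas
-- theorem [N choose K]_ω = (N₁ choose K₁) [N₀ choose K₀]_ω for base-d digits N = N₀ + N₁ d,
-- K = K₀ + K₁ d. The q-multinomial is a product of three q-binomials whose upper arguments are the
-- partial sums n - 2 + a, n - 2 + a + b, n - 2 + a + b + c, and n - 2 has last digit d - 2. In the
-- good cases nothing carries: the ordinary binomials assemble into the multinomial of the quotients,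
-- and the ω-part is [d - 1]_ω = [n - 1]_ω = -ω^(d-1), inverted by -ω. Otherwise the last digits of
-- a, b, c add up to at least 2, so some partial sum carries; the first one that does leaves a last
-- digit smaller than that of the lower argument, and its factor vanishes.

open import Defs
open import Level using (Level)
open import Algebra.Bundles using (CommutativeRing)
open import Data.Nat as ℕ using (ℕ; zero; suc; _∸_; _≤_; _<_; z≤n; s≤s; NonZero; _!)
open import Data.Nat.Properties
  using (m+n∸n≡m; m≤n+m; m*n≢0; _!≢0; _!*_!≢0; m<n⇒m<1+n; n<1+n; ≤-<-connex; m+[n∸m]≡n)
import Data.Nat.Properties as ℕₚ
open import Data.Nat.DivMod
  using (_/_; _%_; m≡m%n+[m/n]*n; m%n<n; 0/n≡0; [m+kn]%n≡m%n; m<n⇒m%n≡m; +-distrib-/; m<n⇒m/n≡0; m*n/n≡m; m*n%n≡0; m/n*n≡m; /-congˡ)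
open import Data.Nat.Combinatorics using (_C_; nCk+nC[k+1]≡[n+1]C[k+1]; k![n∸k]!∣n!)
open import Data.Nat.Combinatorics.Specification using (nCk≡n!/k![n-k]!)
open import Data.Nat.Divisibility using (_∣_; divides)
open import Data.Nat.Tactic.RingSolver using (solve-∀)
open import Data.Product using (_×_; _,_; proj₁; proj₂; Σ-syntax)
open import Data.Sum using (_⊎_; inj₁; inj₂)
open import Data.Empty using (⊥-elim)
open import Relation.Nullary using (¬_; yes; no)
open import Relation.Binary.PropositionalEquality as ≡
  using (_≡_; cong; cong₂; subst; subst₂; module ≡-Reasoning)

module _ where
  open import Data.Nat using (_+_; _*_)

  m<n⇒[m+kn]/n≡k : ∀ {m n} .{{_ : NonZero n}} k → m < n → (m + k * n) / n ≡ k
  m<n⇒[m+kn]/n≡k {m} {n} k m<n = begin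
    (m + k * n) / n     ≡⟨ +-distrib-/ m (k * n) remainders<n ⟩
    m / n + k * n / n   ≡⟨ cong₂ _+_ (m<n⇒m/n≡0 m<n) (m*n/n≡m k n) ⟩
    k                   ∎
    where
    open ≡-Reasoning
    remainders<n : m % n + k * n % n < n
    remainders<n = subst (_< n) (≡.sym (cong₂ _+_ (m<n⇒m%n≡m m<n) (m*n%n≡0 k n)))
                     (subst (_< n) (≡.sym (ℕₚ.+-identityʳ m)) m<n)

  digits-unique : ∀ {d} .{{_ : NonZero d}} {N r q} → r < d → N ≡ r + q * d → N / d ≡ q × N % d ≡ r
  digits-unique {d} {r = r} {q} r<d ≡.refl = m<n⇒[m+kn]/n≡k q r<d , ≡.trans ([m+kn]%n≡m%n r q d) (m<n⇒m%n≡m r<d)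

  +-digits : ∀ r M s K d → (r + M * d) + (s + K * d) ≡ (r + s) + (M + K) * d
  +-digits = solve-∀

  partial-digits : ∀ r M a A b B d →
    (r + M * d) + (a + A * d) + (b + B * d) ≡ (r + a + b) + (M + A + B) * d
  partial-digits = solve-∀

  m+x+y+z≡x+y+z+m : ∀ m x y z → m + x + y + z ≡ x + y + z + m
  m+x+y+z≡x+y+z+m = solve-∀

  [m+n]Cn*[n!*m!]≡[m+n]! : ∀ m n → ((m + n) C n) * (n ! * m !) ≡ (m + n) !
  [m+n]Cn*[n!*m!]≡[m+n]! m n = begin
    ((m + n) C n) * (n ! * m !)
      ≡⟨ cong (λ k → ((m + n) C n) * (n ! * k !)) (≡.sym (m+n∸n≡m m n)) ⟩
    ((m + n) C n) * (n ! * (m + n ∸ n) !)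
      ≡⟨ cong (_* (n ! * (m + n ∸ n) !)) (nCk≡n!/k![n-k]! n≤m+n) ⟩
    (m + n) ! / (n ! * (m + n ∸ n) !) * (n ! * (m + n ∸ n) !)
      ≡⟨ m/n*n≡m (k![n∸k]!∣n! n≤m+n) ⟩
    (m + n) ! ∎
    where
    open ≡-Reasoning
    n≤m+n : n ≤ m + n
    n≤m+n = m≤n+m n m
    instance
      factorials≢0 : NonZero (n ! * (m + n ∸ n) !)
      factorials≢0 = _!*_!≢0 n (m + n ∸ n)

  multinomial≡product-of-binomials : ∀ k₁ k₂ k₃ k₄ →
    multinomial (k₁ + k₂ + k₃ + k₄) k₁ k₂ k₃ k₄
      ≡ ((k₁ + k₂) C k₂) * ((k₁ + k₂ + k₃) C k₃) * ((k₁ + k₂ + k₃ + k₄) C k₄)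
  multinomial≡product-of-binomials k₁ k₂ k₃ k₄ =
    ≡.trans (/-congˡ (≡.sym product*factorials≡!)) (m*n/n≡m product factorials)
    where
    open ≡-Reasoning
    c₂ c₃ c₄ product factorials : ℕ
    c₂ = (k₁ + k₂) C k₂
    c₃ = (k₁ + k₂ + k₃) C k₃
    c₄ = (k₁ + k₂ + k₃ + k₄) C k₄
    product = c₂ * c₃ * c₄
    factorials = k₁ ! * k₂ ! * k₃ ! * k₄ !
    instance
      factorials≢0 : NonZero factorials
      factorials≢0 = m*n≢0 _ _ {{m*n≢0 _ _ {{m*n≢0 _ _ {{k₁ !≢0}} {{k₂ !≢0}}}} {{k₃ !≢0}}}} {{k₄ !≢0}}
    regroup : ∀ c₂ c₃ c₄ f₁ f₂ f₃ f₄ →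
      (c₂ * c₃ * c₄) * (f₁ * f₂ * f₃ * f₄) ≡ c₄ * (f₄ * (c₃ * (f₃ * (c₂ * (f₂ * f₁)))))
    regroup = solve-∀
    product*factorials≡! : product * factorials ≡ (k₁ + k₂ + k₃ + k₄) !
    product*factorials≡! = begin
      product * factorials
        ≡⟨ regroup c₂ c₃ c₄ (k₁ !) (k₂ !) (k₃ !) (k₄ !) ⟩
      c₄ * (k₄ ! * (c₃ * (k₃ ! * (c₂ * (k₂ ! * k₁ !)))))
        ≡⟨ cong (λ x → c₄ * (k₄ ! * (c₃ * (k₃ ! * x)))) ([m+n]Cn*[n!*m!]≡[m+n]! k₁ k₂) ⟩
      c₄ * (k₄ ! * (c₃ * (k₃ ! * (k₁ + k₂) !)))
        ≡⟨ cong (λ x → c₄ * (k₄ ! * x)) ([m+n]Cn*[n!*m!]≡[m+n]! (k₁ + k₂) k₃) ⟩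
      c₄ * (k₄ ! * (k₁ + k₂ + k₃) !)
        ≡⟨ [m+n]Cn*[n!*m!]≡[m+n]! (k₁ + k₂ + k₃) k₄ ⟩
      (k₁ + k₂ + k₃ + k₄) ! ∎

  residues≥2 : ∀ {e} a b c → ¬ Good (suc (suc e)) a b c → ¬ Excluded (suc (suc e)) a b c →
    2 ≤ a % suc (suc e) + b % suc (suc e) + c % suc (suc e)
  residues≥2 {e} a b c ¬good ¬excluded
    with a % suc (suc e) | b % suc (suc e) | c % suc (suc e)
  ... | suc (suc _) | _           | _           = s≤s (s≤s z≤n)
  ... | 1           | suc _       | _           = s≤s (s≤s z≤n)
  ... | 1           | 0           | suc _       = s≤s (s≤s z≤n)
  ... | 0           | suc (suc _) | _           = s≤s (s≤s z≤n)
  ... | 0           | 1           | suc _       = s≤s (s≤s z≤n)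
  ... | 0           | 0           | suc (suc _) = s≤s (s≤s z≤n)
  ... | 1           | 0           | 0           = ⊥-elim (¬good (inj₁ (≡.refl , ≡.refl , ≡.refl)))
  ... | 0           | 1           | 0           = ⊥-elim (¬good (inj₂ (inj₁ (≡.refl , ≡.refl , ≡.refl))))
  ... | 0           | 0           | 1           = ⊥-elim (¬good (inj₂ (inj₂ (inj₁ (≡.refl , ≡.refl , ≡.refl)))))
  ... | 0           | 0           | 0           with e
  ...   | zero  = ⊥-elim (¬good (inj₂ (inj₂ (inj₂ (≡.refl , ≡.refl , ≡.refl , ≡.refl)))))
  ...   | suc _ = ⊥-elim (¬excluded (s≤s (s≤s (s≤s z≤n)) , ≡.refl , ≡.refl , ≡.refl))

  residues≤1 : ∀ {e} a b c → Good (suc (suc e)) a b c → a % suc (suc e) + b % suc (suc e) + c % suc (suc e) ≤ 1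
  residues≤1 a b c (inj₁ (a≡1 , b≡0 , c≡0))                         rewrite a≡1 | b≡0 | c≡0 = s≤s z≤n
  residues≤1 a b c (inj₂ (inj₁ (a≡0 , b≡1 , c≡0)))                  rewrite a≡0 | b≡1 | c≡0 = s≤s z≤n
  residues≤1 a b c (inj₂ (inj₂ (inj₁ (a≡0 , b≡0 , c≡1))))           rewrite a≡0 | b≡0 | c≡1 = s≤s z≤n
  residues≤1 a b c (inj₂ (inj₂ (inj₂ (_ , a≡0 , b≡0 , c≡0))))       rewrite a≡0 | b≡0 | c≡0 = z≤n

  /-digit-sum : ∀ {d} .{{_ : NonZero d}} M a b c → a % d + b % d + c % d < d →
    (M * d + a + b + c) / d ≡ M + a / d + b / d + c / d
  /-digit-sum {d} M a b c residues<d = proj₁ (digits-unique residues<d (begin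
    M * d + a + b + c
      ≡⟨ cong₂ _+_ (cong₂ _+_ (cong (M * d +_) (m≡m%n+[m/n]*n a d)) (m≡m%n+[m/n]*n b d)) (m≡m%n+[m/n]*n c d) ⟩
    M * d + (a % d + a / d * d) + (b % d + b / d * d) + (c % d + c / d * d)
      ≡⟨ regroup M (a % d) (a / d) (b % d) (b / d) (c % d) (c / d) d ⟩
    a % d + b % d + c % d + (M + a / d + b / d + c / d) * d ∎))
    where
    open ≡-Reasoning
    regroup : ∀ M x X y Y z Z d →
      M * d + (x + X * d) + (y + Y * d) + (z + Z * d) ≡ x + y + z + (M + X + Y + Z) * d
    regroup = solve-∀

module QAnalogues {c ℓ : Level} (R : CommutativeRing c ℓ) where
  open CommutativeRing R
  open import Relation.Binary.Reasoning.Setoid setoid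
  open import Algebra.Solver.Ring.NaturalCoefficients.Default commutativeSemiring

  pow-+ : ∀ q m n → pow R q (m ℕ.+ n) ≈ pow R q m * pow R q n
  pow-+ q zero    n = sym (*-identityˡ _)
  pow-+ q (suc m) n = trans (*-congˡ (pow-+ q m n)) (sym (*-assoc _ _ _))

  qInt-+ : ∀ q m n → qInt R q (m ℕ.+ n) ≈ qInt R q m + pow R q m * qInt R q n
  qInt-+ q zero    n = sym (trans (+-identityˡ _) (*-identityˡ _))
  qInt-+ q (suc m) n = begin
    1# + q * qInt R q (m ℕ.+ n)
      ≈⟨ +-congˡ (*-congˡ (qInt-+ q m n)) ⟩
    1# + q * (qInt R q m + pow R q m * qInt R q n)
      ≈⟨ solve 4 (λ q i p j → con 1 :+ q :* (i :+ p :* j) := (con 1 :+ q :* i) :+ (q :* p) :* j)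
               refl q (qInt R q m) (pow R q m) (qInt R q n) ⟩
    (1# + q * qInt R q m) + (q * pow R q m) * qInt R q n ∎

  qInt-suc : ∀ q n → qInt R q (suc n) ≈ qInt R q n + pow R q n
  qInt-suc q n = begin
    qInt R q (suc n)                        ≡⟨ cong (qInt R q) (ℕₚ.+-comm 1 n) ⟩
    qInt R q (n ℕ.+ 1)                      ≈⟨ qInt-+ q n 1 ⟩
    qInt R q n + pow R q n * (1# + q * 0#)  ≈⟨ +-congˡ (solve 2 (λ p q → p :* (con 1 :+ q :* con 0) := p) refl (pow R q n) q) ⟩
    qInt R q n + pow R q n                  ∎

  fromℕ-+ : ∀ m n → fromℕ R (m ℕ.+ n) ≈ fromℕ R m + fromℕ R n
  fromℕ-+ zero    n = sym (+-identityˡ _)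
  fromℕ-+ (suc m) n = trans (+-congˡ (fromℕ-+ m n)) (sym (+-assoc _ _ _))

  fromℕ-* : ∀ m n → fromℕ R (m ℕ.* n) ≈ fromℕ R m * fromℕ R n
  fromℕ-* zero    n = sym (zeroˡ _)
  fromℕ-* (suc m) n = begin
    fromℕ R (n ℕ.+ m ℕ.* n)            ≈⟨ fromℕ-+ n (m ℕ.* n) ⟩
    fromℕ R n + fromℕ R (m ℕ.* n)      ≈⟨ +-congˡ (fromℕ-* m n) ⟩
    fromℕ R n + fromℕ R m * fromℕ R n  ≈⟨ solve 2 (λ x y → y :+ x :* y := (con 1 :+ x) :* y) refl (fromℕ R m) (fromℕ R n) ⟩
    (1# + fromℕ R m) * fromℕ R n       ∎

  qBinom-zero : ∀ q {n k} → n < k → qBinom R q n k ≈ 0#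
  qBinom-zero q {zero}  {suc k} _         = refl
  qBinom-zero q {suc n} {suc k} (s≤s n<k) = begin
    qBinom R q n k + pow R q (suc k) * qBinom R q n (suc k)
      ≈⟨ +-cong (qBinom-zero q n<k) (*-congˡ (qBinom-zero q (m<n⇒m<1+n n<k))) ⟩
    0# + pow R q (suc k) * 0#   ≈⟨ trans (+-identityˡ _) (zeroʳ _) ⟩
    0#                          ∎

  qBinom-diag : ∀ q n → qBinom R q n n ≈ 1#
  qBinom-diag q zero    = refl
  qBinom-diag q (suc n) = begin
    qBinom R q n n + pow R q (suc n) * qBinom R q n (suc n) ≈⟨ +-cong (qBinom-diag q n) (*-congˡ (qBinom-zero q (n<1+n n))) ⟩
    1# + pow R q (suc n) * 0#                               ≈⟨ trans (+-congˡ (zeroʳ _)) (+-identityʳ _) ⟩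
    1#                                                      ∎

  qBinom-one : ∀ q n → qBinom R q n 1 ≈ qInt R q n
  qBinom-one q zero    = refl
  qBinom-one q (suc n) = +-congˡ (*-cong (*-identityʳ q) (qBinom-one q n))

  qBinom-one-at : ∀ q {m n} → m ≡ n → qBinom R q m 1 ≈ qInt R q n
  qBinom-one-at q {m} ≡.refl = qBinom-one q m

  qMultinomial4-residues : ∀ q {e} a b c → Good (suc (suc e)) a b c →
    qMultinomial4 R q e (a % suc (suc e)) (b % suc (suc e)) (c % suc (suc e)) ≈ qInt R q (suc e)
  qMultinomial4-residues q {e} a b c (inj₁ (a≡1 , b≡0 , c≡0)) rewrite a≡1 | b≡0 | c≡0 =
    trans (*-identityʳ _) (trans (*-identityʳ _) (qBinom-one-at q (ℕₚ.+-comm e 1)))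
  qMultinomial4-residues q {e} a b c (inj₂ (inj₁ (a≡0 , b≡1 , c≡0))) rewrite a≡0 | b≡1 | c≡0 | ℕₚ.+-identityʳ e =
    trans (*-identityʳ _) (trans (*-identityˡ _) (qBinom-one-at q (ℕₚ.+-comm e 1)))
  qMultinomial4-residues q {e} a b c (inj₂ (inj₂ (inj₁ (a≡0 , b≡0 , c≡1)))) rewrite a≡0 | b≡0 | c≡1 | ℕₚ.+-identityʳ e | ℕₚ.+-identityʳ e =
    trans (*-congʳ (*-identityʳ 1#)) (trans (*-identityˡ _) (qBinom-one-at q (ℕₚ.+-comm e 1)))
  qMultinomial4-residues q a b c (inj₂ (inj₂ (inj₂ (≡.refl , a≡0 , b≡0 , c≡0)))) rewrite a≡0 | b≡0 | c≡0 =
    sym (trans (+-congˡ (zeroʳ q)) (trans (+-identityʳ 1#) (sym (trans (*-identityʳ _) (*-identityʳ _)))))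

  qFactorial : Carrier → ℕ → Carrier
  qFactorial q zero    = 1#
  qFactorial q (suc k) = qInt R q (suc k) * qFactorial q k

  qFallingFactorial : Carrier → ℕ → ℕ → Carrier
  qFallingFactorial q n       zero    = 1#
  qFallingFactorial q zero    (suc k) = 0#
  qFallingFactorial q (suc n) (suc k) = qInt R q (suc n) * qFallingFactorial q n k

  qFallingFactorial-zero : ∀ q {n k} → n < k → qFallingFactorial q n k ≈ 0#
  qFallingFactorial-zero q {zero}  {suc k} _         = refl
  qFallingFactorial-zero q {suc n} {suc k} (s≤s n<k) = trans (*-congˡ (qFallingFactorial-zero q n<k)) (zeroʳ _)

  qFallingFactorial-suc : ∀ q {n k} → k ≤ n →
    qFallingFactorial q n (suc k) ≈ qFallingFactorial q n k * qInt R q (n ∸ k)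
  qFallingFactorial-suc q {zero}  {zero}  _         = sym (zeroʳ _)
  qFallingFactorial-suc q {suc n} {zero}  _         = *-comm _ _
  qFallingFactorial-suc q {suc n} {suc k} (s≤s k≤n) =
    trans (*-congˡ (qFallingFactorial-suc q k≤n)) (sym (*-assoc _ _ _))

  qFallingFactorial-head : ∀ q n k → qInt R q n ≈ 0# → qFallingFactorial q n (suc k) ≈ 0#
  qFallingFactorial-head q zero    k _     = refl
  qFallingFactorial-head q (suc n) k [n]≈0 = trans (*-congʳ [n]≈0) (zeroˡ _)

  qBinom*qFactorial≈qFallingFactorial : ∀ q n k → qBinom R q n k * qFactorial q k ≈ qFallingFactorial q n k
  qBinom*qFactorial≈qFallingFactorial q n       zero    = *-identityˡ _
  qBinom*qFactorial≈qFallingFactorial q zero    (suc k) = zeroˡ _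
  qBinom*qFactorial≈qFallingFactorial q (suc n) (suc k) = begin
    (qBinom R q n k + x * qBinom R q n (suc k)) * ([k+1] * qFactorial q k)
      ≈⟨ solve 5 (λ b x b′ i f → (b :+ x :* b′) :* (i :* f) := i :* (b :* f) :+ x :* (b′ :* (i :* f)))
               refl (qBinom R q n k) x (qBinom R q n (suc k)) [k+1] (qFactorial q k) ⟩
    [k+1] * (qBinom R q n k * qFactorial q k) + x * (qBinom R q n (suc k) * qFactorial q (suc k))
      ≈⟨ +-cong (*-congˡ (qBinom*qFactorial≈qFallingFactorial q n k))
                (*-congˡ (qBinom*qFactorial≈qFallingFactorial q n (suc k))) ⟩
    [k+1] * qFallingFactorial q n k + x * qFallingFactorial q n (suc k)
      ≈⟨ pascal (≤-<-connex k n) ⟩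
    qInt R q (suc n) * qFallingFactorial q n k ∎
    where
    x [k+1] : Carrier
    x = pow R q (suc k)
    [k+1] = qInt R q (suc k)
    pascal : k ≤ n ⊎ n < k →
      [k+1] * qFallingFactorial q n k + x * qFallingFactorial q n (suc k) ≈ qInt R q (suc n) * qFallingFactorial q n k
    pascal (inj₁ k≤n) = begin
      [k+1] * F + x * qFallingFactorial q n (suc k) ≈⟨ +-congˡ (*-congˡ (qFallingFactorial-suc q k≤n)) ⟩
      [k+1] * F + x * (F * qInt R q (n ∸ k))      ≈⟨ solve 4 (λ i f x j → i :* f :+ x :* (f :* j) := (i :+ x :* j) :* f)
                                                             refl [k+1] F x (qInt R q (n ∸ k)) ⟩
      ([k+1] + x * qInt R q (n ∸ k)) * F          ≈⟨ *-congʳ (sym (qInt-+ q (suc k) (n ∸ k))) ⟩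
      qInt R q (suc k ℕ.+ (n ∸ k)) * F            ≡⟨ cong (λ m → qInt R q (suc m) * F) (m+[n∸m]≡n k≤n) ⟩
      qInt R q (suc n) * F                        ∎
      where
      F : Carrier
      F = qFallingFactorial q n k
    pascal (inj₂ n<k) = begin
      [k+1] * qFallingFactorial q n k + x * qFallingFactorial q n (suc k)
        ≈⟨ +-cong (*-congˡ (qFallingFactorial-zero q n<k)) (*-congˡ (qFallingFactorial-zero q (m<n⇒m<1+n n<k))) ⟩
      [k+1] * 0# + x * 0#                         ≈⟨ solve 3 (λ i x j → i :* con 0 :+ x :* con 0 := j :* con 0) refl [k+1] x (qInt R q (suc n)) ⟩
      qInt R q (suc n) * 0#                       ≈⟨ *-congˡ (sym (qFallingFactorial-zero q n<k)) ⟩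
      qInt R q (suc n) * qFallingFactorial q n k  ∎

module PrimitiveRoot {c ℓ : Level} (R : CommutativeRing c ℓ) (domain : IsIntegralDomain R)
                     (d : ℕ) (1<d : 1 < d)
                     (ω : CommutativeRing.Carrier R) (ω-primitive : IsPrimitiveRoot R d ω) where
  open CommutativeRing R
  open QAnalogues R
  open import Relation.Binary.Reasoning.Setoid setoid
  open import Algebra.Solver.Ring.NaturalCoefficients.Default commutativeSemiring
  open import Algebra.Properties.Group +-group using (inverseˡ-unique; ⁻¹-involutive; ∙-cancelˡ)
  open import Algebra.Properties.Ring ring using (-1*x≈-x; -‿distribˡ-*; -‿distribʳ-*)

  0<d : 0 < d
  0<d = ℕₚ.<-trans (s≤s z≤n) 1<d

  instance
    d≢0 : NonZero d
    d≢0 = ℕ.>-nonZero 0<d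

  cancelʳ-nonzero : ∀ {x y} → ¬ y ≈ 0# → x * y ≈ 0# → x ≈ 0#
  cancelʳ-nonzero y≉0 xy≈0 with proj₂ domain _ _ xy≈0
  ... | inj₁ x≈0 = x≈0
  ... | inj₂ y≈0 = ⊥-elim (y≉0 y≈0)

  ωᵈ≈1 : pow R ω d ≈ 1#
  ωᵈ≈1 = proj₁ ω-primitive

  ω≉1 : ¬ ω ≈ 1#
  ω≉1 ω≈1 = proj₂ ω-primitive 1 (s≤s z≤n) 1<d (trans (*-identityʳ ω) ω≈1)

  pow-multiple : ∀ k → pow R ω (k ℕ.* d) ≈ 1#
  pow-multiple zero    = refl
  pow-multiple (suc k) = trans (pow-+ ω d (k ℕ.* d)) (trans (*-cong ωᵈ≈1 (pow-multiple k)) (*-identityˡ 1#))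

  pow-mod : ∀ N → pow R ω N ≈ pow R ω (N % d)
  pow-mod N = begin
    pow R ω N                                   ≡⟨ cong (pow R ω) (m≡m%n+[m/n]*n N d) ⟩
    pow R ω (N % d ℕ.+ N / d ℕ.* d)             ≈⟨ pow-+ ω (N % d) (N / d ℕ.* d) ⟩
    pow R ω (N % d) * pow R ω (N / d ℕ.* d)     ≈⟨ *-congˡ (pow-multiple (N / d)) ⟩
    pow R ω (N % d) * 1#                        ≈⟨ *-identityʳ _ ⟩
    pow R ω (N % d)                             ∎

  ω*qInt-d≈qInt-d : ω * qInt R ω d ≈ qInt R ω d
  ω*qInt-d≈qInt-d = ∙-cancelˡ 1# _ _ (trans (qInt-suc ω d) (trans (+-congˡ ωᵈ≈1) (+-comm _ _)))

  qInt-d≈0 : qInt R ω d ≈ 0#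
  qInt-d≈0 with proj₂ domain (ω + - 1#) (qInt R ω d) (begin
      (ω + - 1#) * qInt R ω d               ≈⟨ distribʳ _ ω (- 1#) ⟩
      ω * qInt R ω d + - 1# * qInt R ω d    ≈⟨ +-cong ω*qInt-d≈qInt-d (-1*x≈-x _) ⟩
      qInt R ω d + - qInt R ω d             ≈⟨ -‿inverseʳ _ ⟩
      0#                                    ∎)
  ... | inj₁ ω-1≈0 = ⊥-elim (ω≉1 (trans (inverseˡ-unique ω (- 1#) ω-1≈0) (⁻¹-involutive 1#)))
  ... | inj₂ [d]≈0 = [d]≈0

  qInt-multiple : ∀ k → qInt R ω (k ℕ.* d) ≈ 0#
  qInt-multiple zero    = refl
  qInt-multiple (suc k) = begin
    qInt R ω (d ℕ.+ k ℕ.* d)                        ≈⟨ qInt-+ ω d (k ℕ.* d) ⟩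
    qInt R ω d + pow R ω d * qInt R ω (k ℕ.* d)     ≈⟨ +-cong qInt-d≈0 (*-congˡ (qInt-multiple k)) ⟩
    0# + pow R ω d * 0#                             ≈⟨ trans (+-identityˡ _) (zeroʳ _) ⟩
    0#                                              ∎

  qInt-mod : ∀ r k → qInt R ω (r ℕ.+ k ℕ.* d) ≈ qInt R ω r
  qInt-mod r k = begin
    qInt R ω (r ℕ.+ k ℕ.* d)                        ≈⟨ qInt-+ ω r (k ℕ.* d) ⟩
    qInt R ω r + pow R ω r * qInt R ω (k ℕ.* d)     ≈⟨ +-congˡ (trans (*-congˡ (qInt-multiple k)) (zeroʳ _)) ⟩
    qInt R ω r + 0#                                 ≈⟨ +-identityʳ _ ⟩
    qInt R ω r                                      ∎

  -ω*qInt[d∸1]≈1 : - ω * qInt R ω (d ∸ 1) ≈ 1#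
  -ω*qInt[d∸1]≈1 = begin
    - ω * qInt R ω (d ∸ 1)        ≈⟨ *-congˡ (inverseˡ-unique _ _ [d-1]+ωᵈ⁻¹≈0) ⟩
    - ω * - pow R ω (d ∸ 1)       ≈⟨ sym (-‿distribˡ-* ω _) ⟩
    - (ω * - pow R ω (d ∸ 1))     ≈⟨ -‿cong (sym (-‿distribʳ-* ω _)) ⟩
    - - (ω * pow R ω (d ∸ 1))     ≈⟨ ⁻¹-involutive _ ⟩
    pow R ω (suc (d ∸ 1))         ≡⟨ cong (pow R ω) suc[d∸1]≡d ⟩
    pow R ω d                     ≈⟨ ωᵈ≈1 ⟩
    1#                            ∎
    where
    suc[d∸1]≡d : suc (d ∸ 1) ≡ d
    suc[d∸1]≡d = m+[n∸m]≡n 0<d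
    [d-1]+ωᵈ⁻¹≈0 : qInt R ω (d ∸ 1) + pow R ω (d ∸ 1) ≈ 0#
    [d-1]+ωᵈ⁻¹≈0 = trans (sym (qInt-suc ω (d ∸ 1))) (trans (reflexive (cong (qInt R ω) suc[d∸1]≡d)) qInt-d≈0)

  qInt≉0 : ∀ {i} → 0 < i → i < d → ¬ qInt R ω i ≈ 0#
  qInt≉0 {i} 0<i i<d [i]≈0 = proj₂ ω-primitive i 0<i i<d (begin
    pow R ω i                 ≈⟨ sym (trans (+-congʳ [i]≈0) (+-identityˡ _)) ⟩
    qInt R ω i + pow R ω i    ≈⟨ sym (qInt-suc ω i) ⟩
    1# + ω * qInt R ω i       ≈⟨ +-congˡ (trans (*-congˡ [i]≈0) (zeroʳ ω)) ⟩
    1# + 0#                   ≈⟨ +-identityʳ 1# ⟩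
    1#                        ∎)

  qFactorial≉0 : ∀ {k} → k < d → ¬ qFactorial ω k ≈ 0#
  qFactorial≉0 {zero}  _   = proj₁ domain
  qFactorial≉0 {suc k} k<d [k+1]!≈0 with proj₂ domain _ _ [k+1]!≈0
  ... | inj₁ [k+1]≈0 = qInt≉0 (s≤s z≤n) k<d [k+1]≈0
  ... | inj₂ [k]!≈0  = qFactorial≉0 (ℕₚ.<-trans (n<1+n k) k<d) [k]!≈0

  qBinom-d≈0 : ∀ {j} → 0 < j → j < d → qBinom R ω d j ≈ 0#
  qBinom-d≈0 {suc j} _ j<d = cancelʳ-nonzero (qFactorial≉0 j<d)
    (trans (qBinom*qFactorial≈qFallingFactorial ω d (suc j)) (qFallingFactorial-head ω d j qInt-d≈0))

  -- DigitStep q r q′ r′: the base-d digits (q , r) of N become (q′ , r′) for N + 1.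
  data DigitStep : ℕ → ℕ → ℕ → ℕ → Set where
    no-carry : ∀ {q r} → suc r < d → DigitStep q r q (suc r)
    carry    : ∀ {q r} → suc r ≡ d → DigitStep q r (suc q) 0

  digitStep : ∀ N → DigitStep (N / d) (N % d) (suc N / d) (suc N % d)
  digitStep N with ℕₚ.m≤n⇒m<n∨m≡n (m%n<n N d)
  ... | inj₁ r+1<d =
    let q′ , r′ = digits-unique r+1<d (cong suc (m≡m%n+[m/n]*n N d))
    in subst₂ (DigitStep (N / d) (N % d)) (≡.sym q′) (≡.sym r′) (no-carry r+1<d)
  ... | inj₂ r+1≡d =
    let q′ , r′ = digits-unique 0<d (≡.trans (cong suc (m≡m%n+[m/n]*n N d)) (cong (ℕ._+ N / d ℕ.* d) r+1≡d))
    in subst₂ (DigitStep (N / d) (N % d)) (≡.sym q′) (≡.sym r′) (carry r+1≡d)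

  pascal-digits : ∀ {n ρ n′ ρ′ k σ k′ σ′} → DigitStep n ρ n′ ρ′ → DigitStep k σ k′ σ′ →
    fromℕ R (n C k) * qBinom R ω ρ σ + pow R ω (suc σ) * (fromℕ R (n C k′) * qBinom R ω ρ σ′)
      ≈ fromℕ R (n′ C k′) * qBinom R ω ρ′ σ′
  pascal-digits {n} {ρ} {k = k} {σ} (no-carry _) (no-carry _) =
    solve 4 (λ f b x b′ → f :* b :+ x :* (f :* b′) := f :* (b :+ x :* b′))
      refl (fromℕ R (n C k)) (qBinom R ω ρ σ) (pow R ω (suc σ)) (qBinom R ω ρ (suc σ))
  pascal-digits {n} {ρ} {k = k} {σ} (no-carry ρ+1<d) (carry σ+1≡d) = begin
    fromℕ R (n C k) * qBinom R ω ρ σ + pow R ω (suc σ) * (fromℕ R (n C suc k) * 1#)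
      ≈⟨ +-cong (*-congˡ (qBinom-zero ω ρ<σ)) (*-congʳ ωᵈ⁺¹≈1) ⟩
    fromℕ R (n C k) * 0# + 1# * (fromℕ R (n C suc k) * 1#)
      ≈⟨ trans (+-congʳ (zeroʳ _)) (trans (+-identityˡ _) (*-identityˡ _)) ⟩
    fromℕ R (n C suc k) * 1# ∎
    where
    ρ<σ : ρ < σ
    ρ<σ = ℕₚ.≤-pred (subst (suc ρ <_) (≡.sym σ+1≡d) ρ+1<d)
    ωᵈ⁺¹≈1 : pow R ω (suc σ) ≈ 1#
    ωᵈ⁺¹≈1 = trans (reflexive (cong (pow R ω) σ+1≡d)) ωᵈ≈1
  pascal-digits {n} {ρ} {k = k} {σ} (carry ρ+1≡d) (no-carry σ+1<d) = begin
    fromℕ R (n C k) * qBinom R ω ρ σ + pow R ω (suc σ) * (fromℕ R (n C k) * qBinom R ω ρ (suc σ))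
      ≈⟨ solve 4 (λ f b x b′ → f :* b :+ x :* (f :* b′) := f :* (b :+ x :* b′))
               refl (fromℕ R (n C k)) (qBinom R ω ρ σ) (pow R ω (suc σ)) (qBinom R ω ρ (suc σ)) ⟩
    fromℕ R (n C k) * qBinom R ω (suc ρ) (suc σ)
      ≈⟨ *-congˡ (trans (reflexive (cong (λ m → qBinom R ω m (suc σ)) ρ+1≡d)) (qBinom-d≈0 (s≤s z≤n) σ+1<d)) ⟩
    fromℕ R (n C k) * 0#                      ≈⟨ zeroʳ _ ⟩
    0#                                        ≈⟨ sym (zeroʳ _) ⟩
    fromℕ R (suc n C k) * 0#                  ∎
  pascal-digits {n} {ρ} {k = k} {σ} (carry ρ+1≡d) (carry σ+1≡d) = begin
    fromℕ R (n C k) * qBinom R ω ρ σ + pow R ω (suc σ) * (fromℕ R (n C suc k) * 1#)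
      ≈⟨ +-cong (*-congˡ (trans (reflexive (cong (qBinom R ω ρ) (≡.sym ρ≡σ))) (qBinom-diag ω ρ)))
                (*-congʳ (trans (reflexive (cong (pow R ω) σ+1≡d)) ωᵈ≈1)) ⟩
    fromℕ R (n C k) * 1# + 1# * (fromℕ R (n C suc k) * 1#)
      ≈⟨ solve 2 (λ x y → x :* con 1 :+ con 1 :* (y :* con 1) := (x :+ y) :* con 1) refl (fromℕ R (n C k)) (fromℕ R (n C suc k)) ⟩
    (fromℕ R (n C k) + fromℕ R (n C suc k)) * 1#
      ≈⟨ *-congʳ (sym (fromℕ-+ (n C k) (n C suc k))) ⟩
    fromℕ R (n C k ℕ.+ n C suc k) * 1#       ≡⟨ cong (λ m → fromℕ R m * 1#) (nCk+nC[k+1]≡[n+1]C[k+1] n k) ⟩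
    fromℕ R (suc n C suc k) * 1#             ∎
    where
    ρ≡σ : ρ ≡ σ
    ρ≡σ = ℕₚ.suc-injective (≡.trans ρ+1≡d (≡.sym σ+1≡d))

  lucas : ∀ N K → qBinom R ω N K ≈ fromℕ R ((N / d) C (K / d)) * qBinom R ω (N % d) (K % d)
  lucas N zero rewrite 0/n≡0 d {{d≢0}} | m<n⇒m%n≡m {{d≢0}} 0<d = sym (trans (*-identityʳ _) (+-identityʳ 1#))
  lucas zero (suc K) rewrite 0/n≡0 d {{d≢0}} | m<n⇒m%n≡m {{d≢0}} 0<d
    with suc K / d | suc K % d | m≡m%n+[m/n]*n (suc K) d
  ... | _     | suc _ | _ = sym (zeroʳ _)
  ... | suc _ | zero  | _ = sym (zeroˡ _)
  ... | zero  | zero  | ()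
  lucas (suc N) (suc K) = begin
    qBinom R ω N K + pow R ω (suc K) * qBinom R ω N (suc K)
      ≈⟨ +-cong (lucas N K) (*-cong (*-congˡ (pow-mod K)) (lucas N (suc K))) ⟩
    fromℕ R ((N / d) C (K / d)) * qBinom R ω (N % d) (K % d)
      + pow R ω (suc (K % d)) * (fromℕ R ((N / d) C (suc K / d)) * qBinom R ω (N % d) (suc K % d))
      ≈⟨ pascal-digits (digitStep N) (digitStep K) ⟩
    fromℕ R ((suc N / d) C (suc K / d)) * qBinom R ω (suc N % d) (suc K % d) ∎

  lucas-digits : ∀ {r s} M K → r < d → s < d →
    qBinom R ω (r ℕ.+ M ℕ.* d) (s ℕ.+ K ℕ.* d) ≈ fromℕ R (M C K) * qBinom R ω r s
  lucas-digits M K r<d s<d =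
    let M≡ , r≡ = digits-unique {q = M} r<d ≡.refl
        K≡ , s≡ = digits-unique {q = K} s<d ≡.refl
    in trans (lucas _ _) (reflexive (cong₂ _*_ (cong (fromℕ R) (cong₂ _C_ M≡ K≡)) (cong₂ (qBinom R ω) r≡ s≡)))

  qBinom-no-carry : ∀ {T} r M s K → T ≡ r ℕ.+ M ℕ.* d → r ℕ.+ s < d →
    qBinom R ω (T ℕ.+ (s ℕ.+ K ℕ.* d)) (s ℕ.+ K ℕ.* d) ≈ fromℕ R ((M ℕ.+ K) C K) * qBinom R ω (r ℕ.+ s) s
  qBinom-no-carry r M s K ≡.refl r+s<d = begin
    qBinom R ω (r ℕ.+ M ℕ.* d ℕ.+ (s ℕ.+ K ℕ.* d)) (s ℕ.+ K ℕ.* d)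
      ≡⟨ cong (λ t → qBinom R ω t (s ℕ.+ K ℕ.* d)) (+-digits r M s K d) ⟩
    qBinom R ω (r ℕ.+ s ℕ.+ (M ℕ.+ K) ℕ.* d) (s ℕ.+ K ℕ.* d)
      ≈⟨ lucas-digits (M ℕ.+ K) K r+s<d (ℕₚ.≤-<-trans (m≤n+m s r) r+s<d) ⟩
    fromℕ R ((M ℕ.+ K) C K) * qBinom R ω (r ℕ.+ s) s ∎

  -- a carry leaves the digit t = r + s - d, which is smaller than s
  qBinom-carry : ∀ {T} r M s K → T ≡ r ℕ.+ M ℕ.* d → r < d → s < d → d ≤ r ℕ.+ s →
    qBinom R ω (T ℕ.+ (s ℕ.+ K ℕ.* d)) (s ℕ.+ K ℕ.* d) ≈ 0#
  qBinom-carry r M s K ≡.refl r<d s<d d≤r+s = begin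
    qBinom R ω (r ℕ.+ M ℕ.* d ℕ.+ (s ℕ.+ K ℕ.* d)) (s ℕ.+ K ℕ.* d)
      ≡⟨ cong (λ t → qBinom R ω t (s ℕ.+ K ℕ.* d)) top≡ ⟩
    qBinom R ω (t ℕ.+ suc (M ℕ.+ K) ℕ.* d) (s ℕ.+ K ℕ.* d)
      ≈⟨ lucas-digits (suc (M ℕ.+ K)) K (ℕₚ.<-trans t<s s<d) s<d ⟩
    fromℕ R (suc (M ℕ.+ K) C K) * qBinom R ω t s
      ≈⟨ trans (*-congˡ (qBinom-zero ω t<s)) (zeroʳ _) ⟩
    0# ∎
    where
    t : ℕ
    t = r ℕ.+ s ∸ d
    t+d≡r+s : t ℕ.+ d ≡ r ℕ.+ s
    t+d≡r+s = ℕₚ.m∸n+n≡m d≤r+s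
    t<s : t < s
    t<s = ℕₚ.+-cancelʳ-< d t s (subst (_< s ℕ.+ d) (≡.sym t+d≡r+s)
            (subst (r ℕ.+ s <_) (ℕₚ.+-comm d s) (ℕₚ.+-monoˡ-< s r<d)))
    top≡ : r ℕ.+ M ℕ.* d ℕ.+ (s ℕ.+ K ℕ.* d) ≡ t ℕ.+ suc (M ℕ.+ K) ℕ.* d
    top≡ = ≡.trans (+-digits r M s K d)
             (≡.trans (cong (ℕ._+ (M ℕ.+ K) ℕ.* d) (≡.sym t+d≡r+s)) (ℕₚ.+-assoc t d ((M ℕ.+ K) ℕ.* d)))

  qMultinomial4-no-carry : ∀ {n₁ n₂ n₃ n₄ r a b c} M A B W →
    n₁ ≡ r ℕ.+ M ℕ.* d → n₂ ≡ a ℕ.+ A ℕ.* d → n₃ ≡ b ℕ.+ B ℕ.* d → n₄ ≡ c ℕ.+ W ℕ.* d →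
    r ℕ.+ a ℕ.+ b ℕ.+ c < d →
    qMultinomial4 R ω n₁ n₂ n₃ n₄ ≈ fromℕ R (multinomial (M ℕ.+ A ℕ.+ B ℕ.+ W) M A B W) * qMultinomial4 R ω r a b c
  qMultinomial4-no-carry {r = r} {a} {b} {c} M A B W ≡.refl ≡.refl ≡.refl ≡.refl r+a+b+c<d = begin
    qMultinomial4 R ω (r ℕ.+ M ℕ.* d) (a ℕ.+ A ℕ.* d) (b ℕ.+ B ℕ.* d) (c ℕ.+ W ℕ.* d)
      ≈⟨ *-cong (*-cong (qBinom-no-carry r M a A ≡.refl r+a<d)
                        (qBinom-no-carry (r ℕ.+ a) (M ℕ.+ A) b B (+-digits r M a A d) r+a+b<d))
                (qBinom-no-carry (r ℕ.+ a ℕ.+ b) (M ℕ.+ A ℕ.+ B) c W (partial-digits r M a A b B d) r+a+b+c<d) ⟩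
    (f₁ * x₁) * (f₂ * x₂) * (f₃ * x₃)
      ≈⟨ solve 6 (λ f₁ x₁ f₂ x₂ f₃ x₃ → (f₁ :* x₁) :* (f₂ :* x₂) :* (f₃ :* x₃) := (f₁ :* f₂ :* f₃) :* (x₁ :* x₂ :* x₃))
               refl f₁ x₁ f₂ x₂ f₃ x₃ ⟩
    (f₁ * f₂ * f₃) * qMultinomial4 R ω r a b c
      ≈⟨ *-congʳ (sym (trans (fromℕ-* (C₁ ℕ.* C₂) C₃) (*-congʳ (fromℕ-* C₁ C₂)))) ⟩
    fromℕ R (C₁ ℕ.* C₂ ℕ.* C₃) * qMultinomial4 R ω r a b c
      ≡⟨ cong (λ k → fromℕ R k * qMultinomial4 R ω r a b c) (≡.sym (multinomial≡product-of-binomials M A B W)) ⟩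
    fromℕ R (multinomial (M ℕ.+ A ℕ.+ B ℕ.+ W) M A B W) * qMultinomial4 R ω r a b c ∎
    where
    C₁ C₂ C₃ : ℕ
    C₁ = (M ℕ.+ A) C A
    C₂ = (M ℕ.+ A ℕ.+ B) C B
    C₃ = (M ℕ.+ A ℕ.+ B ℕ.+ W) C W
    f₁ f₂ f₃ x₁ x₂ x₃ : Carrier
    f₁ = fromℕ R C₁
    f₂ = fromℕ R C₂
    f₃ = fromℕ R C₃
    x₁ = qBinom R ω (r ℕ.+ a) a
    x₂ = qBinom R ω (r ℕ.+ a ℕ.+ b) b
    x₃ = qBinom R ω (r ℕ.+ a ℕ.+ b ℕ.+ c) c
    r+a+b<d : r ℕ.+ a ℕ.+ b < d
    r+a+b<d = ℕₚ.≤-<-trans (ℕₚ.m≤m+n (r ℕ.+ a ℕ.+ b) c) r+a+b+c<d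
    r+a<d : r ℕ.+ a < d
    r+a<d = ℕₚ.≤-<-trans (ℕₚ.m≤m+n (r ℕ.+ a) b) r+a+b<d

  qMultinomial4-carry : ∀ {n₁ n₂ n₃ n₄ r a b c} M A B W →
    n₁ ≡ r ℕ.+ M ℕ.* d → n₂ ≡ a ℕ.+ A ℕ.* d → n₃ ≡ b ℕ.+ B ℕ.* d → n₄ ≡ c ℕ.+ W ℕ.* d →
    r < d → a < d → b < d → c < d → d ≤ r ℕ.+ a ℕ.+ b ℕ.+ c →
    qMultinomial4 R ω n₁ n₂ n₃ n₄ ≈ 0#
  qMultinomial4-carry {r = r} {a} {b} {c} M A B W ≡.refl ≡.refl ≡.refl ≡.refl r<d a<d b<d c<d d≤r+a+b+c
    with r ℕ.+ a ℕ.<? d | r ℕ.+ a ℕ.+ b ℕ.<? d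
  ... | no r+a≮d | _ =
    trans (*-congʳ (trans (*-congʳ (qBinom-carry r M a A ≡.refl r<d a<d (ℕₚ.≮⇒≥ r+a≮d))) (zeroˡ _))) (zeroˡ _)
  ... | yes r+a<d | no r+a+b≮d =
    trans (*-congʳ (trans (*-congˡ (qBinom-carry (r ℕ.+ a) (M ℕ.+ A) b B (+-digits r M a A d) r+a<d b<d (ℕₚ.≮⇒≥ r+a+b≮d))) (zeroʳ _))) (zeroˡ _)
  ... | yes _ | yes r+a+b<d =
    trans (*-congˡ (qBinom-carry (r ℕ.+ a ℕ.+ b) (M ℕ.+ A ℕ.+ B) c W (partial-digits r M a A b B d) r+a+b<d c<d d≤r+a+b+c)) (zeroʳ _)

open import Data.Nat using (_+_)

module QMultinomialAtMultipleOfOrder {c ℓ : Level} (R : CommutativeRing c ℓ) (domain : IsIntegralDomain R)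
                                     (e : ℕ) (ω : CommutativeRing.Carrier R)
                                     (ω-primitive : IsPrimitiveRoot R (suc (suc e)) ω) where
  open CommutativeRing R using (Carrier; _≈_; _*_; -_; 1#; 0#; trans; *-congˡ; *-identityʳ; setoid; *-commutativeSemigroup)
  open QAnalogues R using (qMultinomial4-residues)
  open import Relation.Binary.Reasoning.Setoid setoid
  open import Algebra.Properties.CommutativeSemigroup *-commutativeSemigroup using (x∙yz≈y∙xz)

  d : ℕ
  d = suc (suc e)

  open PrimitiveRoot R domain d (s≤s (s≤s z≤n)) ω ω-primitive

  digits : ∀ x → x ≡ x % d + x / d ℕ.* d
  digits x = m≡m%n+[m/n]*n x d

  -ω*qInt[n∸1]≈1 : ∀ m → - ω * qInt R ω (suc e + m ℕ.* d) ≈ 1#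
  -ω*qInt[n∸1]≈1 m = trans (*-congˡ (qInt-mod (suc e) m)) -ω*qInt[d∸1]≈1

  -ω*qMultinomial4≈multinomial : ∀ m a b c → Good d a b c →
    - ω * qMultinomial4 R ω (e + m ℕ.* d) a b c
      ≈ fromℕ R (multinomial (((suc m ℕ.* d + a + b + c) / d) ∸ 1) ((suc m ℕ.* d / d) ∸ 1) (a / d) (b / d) (c / d))
  -ω*qMultinomial4≈multinomial m a b c good = begin
    - ω * qMultinomial4 R ω (e + m ℕ.* d) a b c
      ≈⟨ *-congˡ (qMultinomial4-no-carry m (a / d) (b / d) (c / d) ≡.refl (digits a) (digits b) (digits c) e+residues<d) ⟩
    - ω * (F * qMultinomial4 R ω e (a % d) (b % d) (c % d))
      ≈⟨ *-congˡ (*-congˡ (qMultinomial4-residues ω a b c good)) ⟩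
    - ω * (F * qInt R ω (suc e))           ≈⟨ x∙yz≈y∙xz (- ω) F _ ⟩
    F * (- ω * qInt R ω (suc e))           ≈⟨ trans (*-congˡ -ω*qInt[d∸1]≈1) (*-identityʳ F) ⟩
    F                                      ≡⟨ cong (fromℕ R) (cong₂ (λ x y → multinomial x y (a / d) (b / d) (c / d)) top≡ m≡) ⟩
    fromℕ R (multinomial (((suc m ℕ.* d + a + b + c) / d) ∸ 1) ((suc m ℕ.* d / d) ∸ 1) (a / d) (b / d) (c / d)) ∎
    where
    F : Carrier
    F = fromℕ R (multinomial (m + a / d + b / d + c / d) m (a / d) (b / d) (c / d))
    residues≤1′ : a % d + b % d + c % d ≤ 1
    residues≤1′ = residues≤1 a b c good
    e+residues<d : e + a % d + b % d + c % d < d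
    e+residues<d = subst (_< d) (≡.sym (m+x+y+z≡x+y+z+m e _ _ _)) (ℕₚ.+-monoˡ-≤ e (s≤s residues≤1′))
    top≡ : m + a / d + b / d + c / d ≡ ((suc m ℕ.* d + a + b + c) / d) ∸ 1
    top≡ = cong (_∸ 1) (≡.sym (/-digit-sum (suc m) a b c (ℕₚ.≤-<-trans residues≤1′ (s≤s (s≤s z≤n)))))
    m≡ : m ≡ (suc m ℕ.* d / d) ∸ 1
    m≡ = cong (_∸ 1) (≡.sym (m*n/n≡m (suc m) d))

  qMultinomial4≈0 : ∀ m a b c → ¬ Good d a b c → ¬ Excluded d a b c → qMultinomial4 R ω (e + m ℕ.* d) a b c ≈ 0#
  qMultinomial4≈0 m a b c ¬good ¬excluded =
    qMultinomial4-carry m (a / d) (b / d) (c / d) ≡.refl (digits a) (digits b) (digits c)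
      (ℕₚ.<-trans (n<1+n e) (n<1+n (suc e))) (m%n<n a d) (m%n<n b d) (m%n<n c d) d≤e+residues
    where
    d≤e+residues : d ≤ e + a % d + b % d + c % d
    d≤e+residues = subst (d ≤_) (≡.sym (m+x+y+z≡x+y+z+m e _ _ _)) (ℕₚ.+-monoˡ-≤ e (residues≥2 a b c ¬good ¬excluded))

lemma3p2 : {c ℓ : Level} (R : CommutativeRing c ℓ) → IsIntegralDomain R →
    (d : ℕ) .{{_ : NonZero d}} → 2 ≤ d →
    (ω : CommutativeRing.Carrier R) → IsPrimitiveRoot R d ω →
    (n : ℕ) → 2 ≤ n → d ∣ n → (a b c : ℕ) →
    (Good d a b c →
      Σ[ u ∈ CommutativeRing.Carrier R ]
        (CommutativeRing._≈_ R (CommutativeRing._*_ R u (qInt R ω (n ∸ 1))) (CommutativeRing.1# R)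
        × CommutativeRing._≈_ R (CommutativeRing._*_ R u (qMultinomial4 R ω (n ∸ 2) a b c))
            (fromℕ R (multinomial (((n + a + b + c) / d) ∸ 1) ((n / d) ∸ 1) (a / d) (b / d) (c / d)))))
    × (¬ Good d a b c → ¬ Excluded d a b c →
      Σ[ u ∈ CommutativeRing.Carrier R ]
        (CommutativeRing._≈_ R (CommutativeRing._*_ R u (qInt R ω (n ∸ 1))) (CommutativeRing.1# R)
        × CommutativeRing._≈_ R (CommutativeRing._*_ R u (qMultinomial4 R ω (n ∸ 2) a b c)) (CommutativeRing.0# R)))
lemma3p2 R domain (suc (suc e)) (s≤s (s≤s _)) ω ω-primitive .0 () (divides zero ≡.refl) a b c
lemma3p2 R domain (suc (suc e)) (s≤s (s≤s _)) ω ω-primitive .(suc m ℕ.* suc (suc e)) _ (divides (suc m) ≡.refl) a b c =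
  (λ good → - ω , -ω*qInt[n∸1]≈1 m , -ω*qMultinomial4≈multinomial m a b c good) ,
  (λ ¬good ¬excluded → - ω , -ω*qInt[n∸1]≈1 m , trans (*-congˡ (qMultinomial4≈0 m a b c ¬good ¬excluded)) (zeroʳ _))
  where
  open CommutativeRing R using (-_; trans; *-congˡ; zeroʳ)
  open QMultinomialAtMultipleOfOrder R domain e ω ω-primitive
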